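{- Let $\Sigma=\{\veebar,\wedge,\vee,\mathbin{\dot\vee}\}$, let $\mathbb{A}_0,\mathbb{B}_0$ be sets of $\Phi$-teams and $k_0\in\mathbb{N}$. If $k_0<D(\mathbb{A}_0,\mathbb{B}_0)$, then D has a winning strategy in the game $\mathrm{FS}^\Sigma_{k_0}(\mathbb{A}_0,\mathbb{B}_0)$.
   Context: A domain $\Phi$ is a finite set of propositional variables; a $\Phi$-team is a set of maps $\Phi\to\{0,1\}$. A split of $T$ is $(T_1,T_2)$ with $T_1,T_2\subseteq T$, $T_1\cup T_2=T$; strict if $T_1\cap T_2=\emptyset$; $\mathrm{Sp}(T)$, $\mathrm{SSp}(T)$ are the sets of splits and strict splits. $\Phi$-literals: $\top,\bot,{\sim}\top,{\sim}\bot,p,\neg p,{\sim}p,{\sim}\neg p$ ($p\in\Phi$), with $T\models\top$ always, $T\models\bot$ iff $T=\emptyset$, $T\models p$ iff $s(p)=1$ for all $s\in T$, $T\models\neg p$ iff $s(p)=0$ for all $s\in T$, $T\models{\sim}\ell$ iff $T\not\models\ell$. A literal $\ell$ separates $\mathbb{A}$ from $\mathbb{B}$ if $A\models\ell$ for all $A\in\mathbb{A}$ and $B\not\models\ell$ for all $B\in\mathbb{B}$. A team $T'$ is a neighbour of $T$ if $T'=T\setminus\{s\}$ for some $s\in T$; $N(T,\mathbb{A})$ is the number of neighbours of $T$ in $\mathbb{A}$; the density is $D(\mathbb{A},\mathbb{B})=\max\{N(A,\mathbb{B}):A\in\mathbb{A}\}$. The game $\mathrm{FS}^\Sigma_{k_0}(\mathbb{A}_0,\mathbb{B}_0)$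 between S and D has positions $(k,\mathbb{A},\mathbb{B})$, starting at $(k_0,\mathbb{A}_0,\mathbb{B}_0)$. If $k_0=0$, D wins. In a position with $k\geq 1$, S makes one of the following moves; in each connective move S also chooses $k_1,k_2>0$ with $k_1+k_2=k$, then D chooses $i\in\{1,2\}$ and play continues from the indicated position. $\veebar$-move: S chooses $\mathbb{A}_1,\mathbb{A}_2\subseteq\mathbb{A}$ with union $\mathbb{A}$; next $(k_i,\mathbb{A}_i,\mathbb{B})$. $\wedge$-move: S chooses $\mathbb{B}_1,\mathbb{B}_2\subseteq\mathbb{B}$ with union $\mathbb{B}$; next $(k_i,\mathbb{A},\mathbb{B}_i)$. $\vee$-move: for each $A\in\mathbb{A}$ S chooses $(A_1,A_2)\in\mathrm{Sp}(A)$, for each $B\in\mathbb{B}$ a function $f_B:\mathrm{Sp}(B)\to\{1,2\}$; $\mathbb{A}_i=\{A_i:A\in\mathbb{A}\}$, $\mathbb{B}_i=\{B_i:B\in\mathbb{B},(B_1,B_2)\in\mathrm{Sp}(B),f_B(B_1,B_2)=i\}$; next $(k_i,\mathbb{A}_i,\mathbb{B}_i)$. $\mathbin{\dot\vee}$-move: as the $\vee$-move with $\mathrm{SSp}$ in place of $\mathrm{Sp}$. Literal move: S chooses a $\Phi$-literal $\ell$; S wins if $\ell$ separates $\mathbb{A}$ from $\mathbb{B}$, otherwise D wins. -}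

module Defs where

open import Data.Nat using (ℕ; zero; suc; _+_; _<_; _⊔_)
open import Data.Bool using (Bool; true; false; _∧_)
open import Data.Fin using (Fin; zero; suc; splitAt)
open import Data.Fin.Subset using (Subset; _∈_; _⊆_; _∪_; _∩_; _-_; Empty; inside; outside)
open import Data.Fin.Subset.Properties using (_∈?_)
open import Data.Fin.Properties using (any?)
open import Data.Vec using (Vec; []; _∷_; lookup)
open import Data.Vec.Properties using (≡-dec)
import Data.Bool.Properties as BoolP
open import Data.List using (List; []; _∷_; _++_; map; length; filterᵇ; foldr)
open import Data.Product using (Σ; ∃; _×_; _,_; proj₁; proj₂)
open import Data.Sum using (_⊎_)
open import Data.Unit using (⊤)
open import Relation.Binary using (Decidable)
open import Relation.Nullary using (¬_; ⌊_⌋; _×-dec_)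
open import Relation.Binary.PropositionalEquality using (_≡_)
import Relation.Unary as U
open import Level using (0ℓ)

-- Domain Φ = {p₀,…,p_{n-1}} = Fin n.
-- Assignments Φ → {0,1} are encoded by indices i : Fin (size n),
-- via the bijection `assign n : Fin (size n) → Vec Bool n`
-- (size n = 2^n; first half ↦ p₀ = 0, second half ↦ p₀ = 1).

size : ℕ → ℕ
size zero    = 1
size (suc n) = size n + size n

assign : (n : ℕ) → Fin (size n) → Vec Bool n
assign zero    _ = []
assign (suc n) i with splitAt (size n) i
... | _⊎_.inj₁ j = false ∷ assign n j
... | _⊎_.inj₂ j = true  ∷ assign n j

module Game (n : ℕ) where

  val : Fin (size n) → Fin n → Bool
  val s p = lookup (assign n s) p

  Team : Set
  Team = Subset (size n)

  TeamSet : Set₁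
  TeamSet = U.Pred (Team) 0ℓ

  IsSplit : Team → Team → Team → Set
  IsSplit T T₁ T₂ = (T₁ ⊆ T) × (T₂ ⊆ T) × (T₁ ∪ T₂ ≡ T)

  IsStrictSplit : Team → Team → Team → Set
  IsStrictSplit T T₁ T₂ = IsSplit T T₁ T₂ × Empty (T₁ ∩ T₂)

  data Atom : Set where
    top bot : Atom
    var neg : Fin n → Atom

  data Literal : Set where
    pos  : Atom → Literal
    tilde : Atom → Literal

  _⊨ᵃ_ : Team → Atom → Set
  T ⊨ᵃ top   = ⊤
  T ⊨ᵃ bot   = Empty T
  T ⊨ᵃ var p = ∀ s → s ∈ T → val s p ≡ true
  T ⊨ᵃ neg p = ∀ s → s ∈ T → val s p ≡ false

  _⊨_ : Team → Literal → Set
  T ⊨ pos a   = T ⊨ᵃ a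
  T ⊨ tilde a = ¬ (T ⊨ᵃ a)

  Separates : Literal → TeamSet → TeamSet → Set
  Separates ℓ 𝔸 𝔹 = (∀ A → 𝔸 A → A ⊨ ℓ) × (∀ B → 𝔹 B → ¬ (B ⊨ ℓ))

  -- component i ∈ {1,2} (encoded as Fin 2: zero ↦ 1, suc zero ↦ 2) of a pair
  comp : {X : Set} → Fin 2 → X × X → X
  comp zero    (x , _) = x
  comp (suc _) (_ , y) = y

  module _ (Sp : Team → Team → Team → Set) where
    SplitChoice : TeamSet → Set
    SplitChoice 𝔸 = ∀ A → 𝔸 A → Σ (Team × Team) λ P → Sp A (proj₁ P) (proj₂ P)

    imgA : (𝔸 : TeamSet) → SplitChoice 𝔸 → Fin 2 → TeamSet
    imgA 𝔸 σ i X = Σ (Team) λ A → Σ (𝔸 A) λ a → comp i (proj₁ (σ A a)) ≡ X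

    imgB : TeamSet → (Team → Team → Team → Fin 2) → Fin 2 → TeamSet
    imgB 𝔹 f i X = Σ (Team) λ B → 𝔹 B × Σ (Team) λ B₁ → Σ (Team) λ B₂ →
                     Sp B B₁ B₂ × f B B₁ B₂ ≡ i × comp i (B₁ , B₂) ≡ X

  data DWins : ℕ → TeamSet → TeamSet → Set₁ where
    win-zero : ∀ {𝔸 𝔹} → DWins 0 𝔸 𝔹
    win-suc  : ∀ {k 𝔸 𝔹} →
      (∀ (ℓ : Literal) → ¬ Separates ℓ 𝔸 𝔹) →
      -- ⊻-move
      (∀ k₁ k₂ → 0 < k₁ → 0 < k₂ → k₁ + k₂ ≡ suc k →
         ∀ (𝔸₁ 𝔸₂ : TeamSet) → 𝔸₁ U.⊆ 𝔸 → 𝔸₂ U.⊆ 𝔸 → 𝔸 U.⊆ (𝔸₁ U.∪ 𝔸₂) →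
         DWins k₁ 𝔸₁ 𝔹 ⊎ DWins k₂ 𝔸₂ 𝔹) →
      -- ∧-move
      (∀ k₁ k₂ → 0 < k₁ → 0 < k₂ → k₁ + k₂ ≡ suc k →
         ∀ (𝔹₁ 𝔹₂ : TeamSet) → 𝔹₁ U.⊆ 𝔹 → 𝔹₂ U.⊆ 𝔹 → 𝔹 U.⊆ (𝔹₁ U.∪ 𝔹₂) →
         DWins k₁ 𝔸 𝔹₁ ⊎ DWins k₂ 𝔸 𝔹₂) →
      -- ∨-move
      (∀ k₁ k₂ → 0 < k₁ → 0 < k₂ → k₁ + k₂ ≡ suc k →
         ∀ (σ : SplitChoice IsSplit 𝔸) (f : Team → Team → Team → Fin 2) →
         DWins k₁ (imgA IsSplit 𝔸 σ zero) (imgB IsSplit 𝔹 f zero)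
         ⊎ DWins k₂ (imgA IsSplit 𝔸 σ (suc zero)) (imgB IsSplit 𝔹 f (suc zero))) →
      -- ∨̇-move
      (∀ k₁ k₂ → 0 < k₁ → 0 < k₂ → k₁ + k₂ ≡ suc k →
         ∀ (σ : SplitChoice IsStrictSplit 𝔸) (f : Team → Team → Team → Fin 2) →
         DWins k₁ (imgA IsStrictSplit 𝔸 σ zero) (imgB IsStrictSplit 𝔹 f zero)
         ⊎ DWins k₂ (imgA IsStrictSplit 𝔸 σ (suc zero)) (imgB IsStrictSplit 𝔹 f (suc zero))) →
      DWins (suc k) 𝔸 𝔹

  allSubsets : (m : ℕ) → List (Subset m)
  allSubsets zero    = [] ∷ []
  allSubsets (suc m) = map (outside ∷_) (allSubsets m) ++ map (inside ∷_) (allSubsets m)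

  _≟ₛ_ : {m : ℕ} → Decidable (_≡_ {A = Subset m})
  _≟ₛ_ = ≡-dec BoolP._≟_

  isNeighbour : Team → Team → Bool
  isNeighbour T' T = ⌊ any? (λ s → (s ∈? T) ×-dec (T' ≟ₛ (T - s))) ⌋

  N : Team → (Team → Bool) → ℕ
  N T 𝔸 = length (filterᵇ (λ X → 𝔸 X ∧ isNeighbour X T) (allSubsets (size n)))

  density : (Team → Bool) → (Team → Bool) → ℕ
  density 𝔸 𝔹 = foldr _⊔_ 0 (map (λ A → N A 𝔹) (filterᵇ 𝔸 (allSubsets (size n))))

  toPred : (Team → Bool) → TeamSet
  toPred 𝔸 T = 𝔸 T ≡ true

-- D keeps the invariant that some A ∈ 𝔸 has more than k points s with A ∖ {s} ∈ 𝔹, which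
-- holds initially because k₀ < D(𝔸₀, 𝔹₀). Every literal is true of A ∖ {s} or of A ∖ {t}
-- whenever it is true of A and s ≠ t (atoms are closed under subteams and under unions, and
-- A = (A ∖ {s}) ∪ (A ∖ {t})), so at k ≥ 1 no literal separates. A connective move with budgets
-- k₁ + k₂ sends each point s to one successor position: for a split (A₁, A₂) of A, the split
-- (A₁ ∖ {s}, A₂ ∖ {s}) of A ∖ {s} is assigned to some side i, and then Aᵢ ∖ {s} ∈ 𝔹ᵢ. By
-- pigeonhole one side i keeps more than kᵢ points.
module Submission where

open import Defs
open import Data.Nat using (ℕ; zero; suc; _+_; _<_; _≤_; _⊔_; s≤s; z≤n; _<?_)
open import Data.Nat.Properties using (+-suc; +-mono-≤; ≮⇒≥; ≤⇒≯; m≤m+n; m≤n+m; m<m+n; m<n+m; ≤-trans; ⊔-sel)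
open import Data.Nat.Induction using (<-rec)
open import Data.Bool using (Bool; T; T?; _∧_)
open import Data.Bool.Properties using (T-∧; T-≡)
open import Data.Fin using (Fin; zero; suc)
open import Data.Fin.Properties using (_≟_; any?)
open import Data.Fin.Subset using (Subset; _⊆_; _∪_; _∩_; _─_; _-_; ⁅_⁆; Empty; inside; outside)
open import Data.Fin.Subset.Properties using (_∈?_; p⊆p∪q; q⊆p∪q; p─q⊆p; x∈p∪q⁺; x∈p∪q⁻; x∈p∩q⁺; x∈p∩q⁻; x∈p∧x≢y⇒x∈p-y)
open import Data.Vec using ([]; _∷_)
open import Data.Vec.Properties using (∷-injectiveʳ)
open import Data.List using ([]; _∷_; map; length; foldr; filterᵇ)
open import Data.List.Properties using (length-map)
open import Data.List.Membership.Propositional using (find) renaming (_∈_ to _∈ₗ_)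
open import Data.List.Membership.Propositional.Properties using (∈-map⁻; ∈-filter⁻)
open import Data.List.Relation.Unary.All as All using (All; []; _∷_)
open import Data.List.Relation.Unary.Any using (Any; here; there)
import Data.List.Relation.Unary.Any.Properties as Any
open import Data.List.Relation.Unary.AllPairs using (AllPairs; []; _∷_)
open import Data.List.Relation.Unary.Unique.Propositional using (Unique)
import Data.List.Relation.Unary.Unique.Propositional.Properties as Unique
open import Data.List.Relation.Binary.Disjoint.Propositional using (Disjoint)
open import Data.List.Relation.Binary.Sublist.Propositional using ([]; _∷_; _∷ʳ_) renaming (_⊆_ to _⊑_)
open import Data.List.Relation.Binary.Sublist.Propositional.Properties using (All-resp-⊆)
open import Data.Product using (∃; ∃₂; _×_; _,_; proj₁; proj₂)
open import Data.Sum using (_⊎_; inj₁; inj₂; [_,_])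
import Data.Sum as Sum
open import Data.Unit using (tt)
open import Function using (_∘_; Equivalence)
open import Relation.Nullary using (¬_; yes; no; contradiction; _×-dec_)
open import Relation.Nullary.Decidable using (toWitness)
open import Relation.Binary.PropositionalEquality using (_≡_; _≢_; refl; sym; trans; cong; subst)
import Relation.Unary as U

module _ {X : Set} where

  MoreThan : ℕ → (X → Set) → Set
  MoreThan k P = ∃ λ xs → Unique xs × k < length xs × All P xs

  MoreThan-weaken : ∀ {j k P} → j ≤ k → MoreThan k P → MoreThan j P
  MoreThan-weaken j≤k (xs , u , k<∣xs∣ , ps) = xs , u , ≤-trans (s≤s j≤k) k<∣xs∣ , ps

  MoreThan-map : ∀ {k} {P Q : X → Set} → (∀ {x} → P x → Q x) → MoreThan k P → MoreThan k Q
  MoreThan-map P⇒Q (xs , u , k<∣xs∣ , ps) = xs , u , k<∣xs∣ , All.map P⇒Q ps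

  MoreThan-pair : ∀ {P} → MoreThan 1 P → ∃₂ λ x y → x ≢ y × P x × P y
  MoreThan-pair ([] , _ , () , _)
  MoreThan-pair (_ ∷ [] , _ , s≤s () , _)
  MoreThan-pair (x ∷ y ∷ _ , (x≢y ∷ _) ∷ _ , _ , px ∷ py ∷ _) = x , y , x≢y , px , py

  AllPairs-resp-⊑ : ∀ {R : X → X → Set} {xs ys} → ys ⊑ xs → AllPairs R xs → AllPairs R ys
  AllPairs-resp-⊑ [] [] = []
  AllPairs-resp-⊑ (_ ∷ʳ ys⊑xs) (_ ∷ rs) = AllPairs-resp-⊑ ys⊑xs rs
  AllPairs-resp-⊑ (refl ∷ ys⊑xs) (r ∷ rs) = All-resp-⊆ ys⊑xs r ∷ AllPairs-resp-⊑ ys⊑xs rs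

  All-⊎-partition : ∀ {P Q : X → Set} {xs} → All (λ x → P x ⊎ Q x) xs →
    ∃₂ λ ys zs → ys ⊑ xs × zs ⊑ xs × length ys + length zs ≡ length xs × All P ys × All Q zs
  All-⊎-partition [] = [] , [] , [] , [] , refl , [] , []
  All-⊎-partition (inj₁ p ∷ pqs) with All-⊎-partition pqs
  ... | ys , zs , ys⊑ , zs⊑ , len , ps , qs =
    _ ∷ ys , zs , refl ∷ ys⊑ , _ ∷ʳ zs⊑ , cong suc len , p ∷ ps , qs
  All-⊎-partition (inj₂ q ∷ pqs) with All-⊎-partition pqs
  ... | ys , zs , ys⊑ , zs⊑ , len , ps , qs =
    ys , _ ∷ zs , _ ∷ʳ ys⊑ , refl ∷ zs⊑ , trans (+-suc (length ys) (length zs)) (cong suc len) , ps , q ∷ qs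

  +-<⇒<⊎< : ∀ {a b m n} → a + b < m + n → a < m ⊎ b < n
  +-<⇒<⊎< {a} {b} {m} {n} a+b<m+n with a <? m | b <? n
  ... | yes a<m | _       = inj₁ a<m
  ... | no _    | yes b<n = inj₂ b<n
  ... | no a≮m  | no b≮n  = contradiction a+b<m+n (≤⇒≯ (+-mono-≤ (≮⇒≥ a≮m) (≮⇒≥ b≮n)))

  MoreThan-⊎ : ∀ {k₁ k₂} {P Q : X → Set} → MoreThan (k₁ + k₂) (λ x → P x ⊎ Q x) →
    MoreThan k₁ P ⊎ MoreThan k₂ Q
  MoreThan-⊎ (xs , u , k<∣xs∣ , pqs) with All-⊎-partition pqs
  ... | ys , zs , ys⊑ , zs⊑ , len , ps , qs =
    Sum.map (λ k₁<∣ys∣ → ys , AllPairs-resp-⊑ ys⊑ u , k₁<∣ys∣ , ps)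
            (λ k₂<∣zs∣ → zs , AllPairs-resp-⊑ zs⊑ u , k₂<∣zs∣ , qs)
            (+-<⇒<⊎< (subst (_ <_) (sym len) k<∣xs∣))

  All-preimage : ∀ {Y : Set} {g : Y → X} {P : Y → Set} {xs} →
    All (λ x → ∃ λ y → g y ≡ x × P y) xs → ∃ λ ys → map g ys ≡ xs × All P ys
  All-preimage [] = [] , refl , []
  All-preimage ((y , refl , py) ∷ h) with All-preimage h
  ... | ys , refl , pys = y ∷ ys , refl , py ∷ pys

∈-filterᵇ⁻ : ∀ {X : Set} (p : X → Bool) xs {x} → x ∈ₗ filterᵇ p xs → T (p x)
∈-filterᵇ⁻ p xs x∈ = proj₂ (∈-filter⁻ (T? ∘ p) {xs = xs} x∈)

<-foldr-⊔⇒Any : ∀ {v} ns → v < foldr _⊔_ 0 ns → Any (v <_) ns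
<-foldr-⊔⇒Any (m ∷ ns) v<max with ⊔-sel m (foldr _⊔_ 0 ns)
... | inj₁ eq = here (subst (_ <_) eq v<max)
... | inj₂ eq = there (<-foldr-⊔⇒Any ns (subst (_ <_) eq v<max))

─-distribʳ-∪ : ∀ {m} (p q r : Subset m) → (p ∪ q) ─ r ≡ (p ─ r) ∪ (q ─ r)
─-distribʳ-∪ [] [] [] = refl
─-distribʳ-∪ (x ∷ p) (y ∷ q) (outside ∷ r) = cong (_ ∷_) (─-distribʳ-∪ p q r)
─-distribʳ-∪ (x ∷ p) (y ∷ q) (inside ∷ r) = cong (_ ∷_) (─-distribʳ-∪ p q r)

p⊆p-x∪p-y : ∀ {m} {p : Subset m} {x y} → x ≢ y → p ⊆ (p - x) ∪ (p - y)
p⊆p-x∪p-y {x = x} x≢y {u} u∈p with u ≟ x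
... | yes refl = x∈p∪q⁺ (inj₂ (x∈p∧x≢y⇒x∈p-y u∈p x≢y))
... | no u≢x   = x∈p∪q⁺ (inj₁ (x∈p∧x≢y⇒x∈p-y u∈p u≢x))

allSubsets-unique : ∀ n m → Unique (Game.allSubsets n m)
allSubsets-unique n zero    = [] ∷ []
allSubsets-unique n (suc m) = Unique.++⁺ (Unique.map⁺ ∷-injectiveʳ (allSubsets-unique n m))
                                         (Unique.map⁺ ∷-injectiveʳ (allSubsets-unique n m)) disjoint
  where
  disjoint : Disjoint (map (outside ∷_) (Game.allSubsets n m)) (map (inside ∷_) (Game.allSubsets n m))
  disjoint (v∈outs , v∈ins) with ∈-map⁻ _ v∈outs | ∈-map⁻ _ v∈ins
  ... | _ , _ , refl | _ , _ , ()

module Strategy (n : ℕ) where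
  open Game n

  -- The removed points s need not lie in A (then A - s = A); dropping that condition is
  -- what makes the invariant stable under ∨-moves.
  record _<D[_,_] (k : ℕ) (𝔸 𝔹 : TeamSet) : Set where
    constructor dense-at
    field
      team      : Team
      team∈     : 𝔸 team
      removals  : MoreThan k (λ s → 𝔹 (team - s))

  IsSplit-─ : ∀ {T T₁ T₂} s → IsSplit T T₁ T₂ → IsSplit (T - s) (T₁ - s) (T₂ - s)
  IsSplit-─ {T₁ = T₁} {T₂} s (_ , _ , refl) rewrite ─-distribʳ-∪ T₁ T₂ ⁅ s ⁆ =
    p⊆p∪q (T₂ - s) , q⊆p∪q (T₁ - s) (T₂ - s) , refl

  IsStrictSplit-─ : ∀ {T T₁ T₂} s → IsStrictSplit T T₁ T₂ → IsStrictSplit (T - s) (T₁ - s) (T₂ - s)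
  IsStrictSplit-─ {T₁ = T₁} {T₂} s (split , disjoint) = IsSplit-─ s split , disjoint-─
    where
    disjoint-─ : Empty ((T₁ - s) ∩ (T₂ - s))
    disjoint-─ (x , x∈) with x∈p∩q⁻ (T₁ - s) (T₂ - s) x∈
    ... | x∈₁ , x∈₂ = disjoint (x , x∈p∩q⁺ (p─q⊆p T₁ ⁅ s ⁆ x∈₁ , p─q⊆p T₂ ⁅ s ⁆ x∈₂))

  ⊨ᵃ-⊆ : ∀ {T T′} a → T′ ⊆ T → T ⊨ᵃ a → T′ ⊨ᵃ a
  ⊨ᵃ-⊆ top     _   _  = tt
  ⊨ᵃ-⊆ bot     T′⊆T T∅ (x , x∈) = T∅ (x , T′⊆T x∈)
  ⊨ᵃ-⊆ (var p) T′⊆T h s s∈ = h s (T′⊆T s∈)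
  ⊨ᵃ-⊆ (neg p) T′⊆T h s s∈ = h s (T′⊆T s∈)

  ⊨ᵃ-∪ : ∀ {T T₁ T₂} a → T ⊆ T₁ ∪ T₂ → T₁ ⊨ᵃ a → T₂ ⊨ᵃ a → T ⊨ᵃ a
  ⊨ᵃ-∪ top _ _ _ = tt
  ⊨ᵃ-∪ {T₁ = T₁} {T₂} bot T⊆ T₁∅ T₂∅ (x , x∈) =
    [ (λ x∈₁ → T₁∅ (x , x∈₁)) , (λ x∈₂ → T₂∅ (x , x∈₂)) ] (x∈p∪q⁻ T₁ T₂ (T⊆ x∈))
  ⊨ᵃ-∪ {T₁ = T₁} {T₂} (var p) T⊆ h₁ h₂ s s∈ = [ h₁ s , h₂ s ] (x∈p∪q⁻ T₁ T₂ (T⊆ s∈))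
  ⊨ᵃ-∪ {T₁ = T₁} {T₂} (neg p) T⊆ h₁ h₂ s s∈ = [ h₁ s , h₂ s ] (x∈p∪q⁻ T₁ T₂ (T⊆ s∈))

  ⊨-survives-one-of-two-removals : ∀ {A s t} ℓ → s ≢ t → A ⊨ ℓ → ¬ (A - s) ⊨ ℓ → (A - t) ⊨ ℓ
  ⊨-survives-one-of-two-removals {A} {s} (pos a) _ A⊨a _ = ⊨ᵃ-⊆ a (p─q⊆p A ⁅ _ ⁆) A⊨a
  ⊨-survives-one-of-two-removals (tilde a) s≢t A⊭a ¬A-s⊭a A-t⊨a =
    ¬A-s⊭a (λ A-s⊨a → A⊭a (⊨ᵃ-∪ a (p⊆p-x∪p-y s≢t) A-s⊨a A-t⊨a))

  literal-move : ∀ {k 𝔸 𝔹} ℓ → suc k <D[ 𝔸 , 𝔹 ] → ¬ Separates ℓ 𝔸 𝔹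
  literal-move ℓ (dense-at A A∈𝔸 removals) (𝔸⊨ℓ , 𝔹⊭ℓ)
    with MoreThan-pair (MoreThan-weaken (s≤s z≤n) removals)
  ... | s , t , s≢t , A-s∈𝔹 , A-t∈𝔹 =
    𝔹⊭ℓ _ A-t∈𝔹 (⊨-survives-one-of-two-removals ℓ s≢t (𝔸⊨ℓ A A∈𝔸) (𝔹⊭ℓ _ A-s∈𝔹))

  ⊻-move : ∀ {k₁ k₂ 𝔸 𝔸₁ 𝔸₂ 𝔹} → (k₁ + k₂) <D[ 𝔸 , 𝔹 ] → 𝔸 U.⊆ 𝔸₁ U.∪ 𝔸₂ →
    k₁ <D[ 𝔸₁ , 𝔹 ] ⊎ k₂ <D[ 𝔸₂ , 𝔹 ]
  ⊻-move {k₁} {k₂} (dense-at A A∈𝔸 removals) 𝔸⊆ =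
    Sum.map (λ A∈𝔸₁ → dense-at A A∈𝔸₁ (MoreThan-weaken (m≤m+n k₁ k₂) removals))
            (λ A∈𝔸₂ → dense-at A A∈𝔸₂ (MoreThan-weaken (m≤n+m k₂ k₁) removals))
            (𝔸⊆ A∈𝔸)

  ∧-move : ∀ {k₁ k₂ 𝔸 𝔹 𝔹₁ 𝔹₂} → (k₁ + k₂) <D[ 𝔸 , 𝔹 ] → 𝔹 U.⊆ 𝔹₁ U.∪ 𝔹₂ →
    k₁ <D[ 𝔸 , 𝔹₁ ] ⊎ k₂ <D[ 𝔸 , 𝔹₂ ]
  ∧-move (dense-at A A∈𝔸 removals) 𝔹⊆ =
    Sum.map (dense-at A A∈𝔸) (dense-at A A∈𝔸) (MoreThan-⊎ (MoreThan-map 𝔹⊆ removals))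

  module _ (Sp : Team → Team → Team → Set)
           (Sp-─ : ∀ {T T₁ T₂} s → Sp T T₁ T₂ → Sp (T - s) (T₁ - s) (T₂ - s)) where

    ∨-move : ∀ {k₁ k₂ 𝔸 𝔹} → (k₁ + k₂) <D[ 𝔸 , 𝔹 ] →
      ∀ (σ : SplitChoice Sp 𝔸) (f : Team → Team → Team → Fin 2) →
      k₁ <D[ imgA Sp 𝔸 σ zero , imgB Sp 𝔹 f zero ] ⊎ k₂ <D[ imgA Sp 𝔸 σ (suc zero) , imgB Sp 𝔹 f (suc zero) ]
    ∨-move {𝔹 = 𝔹} (dense-at A A∈𝔸 removals) σ f =
      Sum.map (dense-at A₁ (A , A∈𝔸 , refl)) (dense-at A₂ (A , A∈𝔸 , refl))
              (MoreThan-⊎ (MoreThan-map chosen removals))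
      where
      A₁ A₂ : Team
      A₁ = proj₁ (proj₁ (σ A A∈𝔸))
      A₂ = proj₂ (proj₁ (σ A A∈𝔸))

      chosen : ∀ {s} → 𝔹 (A - s) → imgB Sp 𝔹 f zero (A₁ - s) ⊎ imgB Sp 𝔹 f (suc zero) (A₂ - s)
      chosen {s} A-s∈𝔹 with f (A - s) (A₁ - s) (A₂ - s) in choice
      ... | zero     = inj₁ (A - s , A-s∈𝔹 , A₁ - s , A₂ - s , Sp-─ s (proj₂ (σ A A∈𝔸)) , choice , refl)
      ... | suc zero = inj₂ (A - s , A-s∈𝔹 , A₁ - s , A₂ - s , Sp-─ s (proj₂ (σ A A∈𝔸)) , choice , refl)

  neighbour-removal : ∀ {A X} (𝔹₀ : Team → Bool) →
    X ∈ₗ filterᵇ (λ Y → 𝔹₀ Y ∧ isNeighbour Y A) (allSubsets (size n)) →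
    ∃ λ s → A - s ≡ X × toPred 𝔹₀ (A - s)
  neighbour-removal {A} {X} 𝔹₀ X∈ with Equivalence.to T-∧ (∈-filterᵇ⁻ _ (allSubsets (size n)) X∈)
  ... | X∈𝔹₀ , X-neighbour
      with toWitness {a? = any? λ s → (s ∈? A) ×-dec (X ≟ₛ (A - s))} X-neighbour
  ...   | s , _ , refl = s , refl , Equivalence.to T-≡ X∈𝔹₀

  <N⇒removals : ∀ {k A} (𝔹₀ : Team → Bool) → k < N A 𝔹₀ → MoreThan k (λ s → toPred 𝔹₀ (A - s))
  <N⇒removals {k} 𝔹₀ k<N with All-preimage (All.tabulate (neighbour-removal 𝔹₀))
  ... | ss , map≡neighbours , removals =
    ss ,
    Unique.map⁻ (subst Unique (sym map≡neighbours) (Unique.filter⁺ _ (allSubsets-unique n (size n)))) ,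
    subst (k <_) (trans (cong length (sym map≡neighbours)) (length-map _ ss)) k<N , removals

  density⇒dense : ∀ {k} (𝔸₀ 𝔹₀ : Team → Bool) → k < density 𝔸₀ 𝔹₀ → k <D[ toPred 𝔸₀ , toPred 𝔹₀ ]
  density⇒dense 𝔸₀ 𝔹₀ k<D
    with find (Any.map⁻ (<-foldr-⊔⇒Any (map (λ A → N A 𝔹₀) (filterᵇ 𝔸₀ (allSubsets (size n)))) k<D))
  ... | A , A∈ , k<N = dense-at A (Equivalence.to T-≡ (∈-filterᵇ⁻ 𝔸₀ (allSubsets (size n)) A∈)) (<N⇒removals 𝔹₀ k<N)

  dense⇒DWins : ∀ k {𝔸 𝔹} → k <D[ 𝔸 , 𝔹 ] → DWins k 𝔸 𝔹
  dense⇒DWins = <-rec _ step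
    where
    step : ∀ k → (∀ {j} → j < k → ∀ {𝔸 𝔹} → j <D[ 𝔸 , 𝔹 ] → DWins j 𝔸 𝔹) →
           ∀ {𝔸 𝔹} → k <D[ 𝔸 , 𝔹 ] → DWins k 𝔸 𝔹
    step zero    _   _     = win-zero
    step (suc k) rec {𝔸} {𝔹} dense =
      win-suc (λ ℓ → literal-move ℓ dense)
        (λ k₁ k₂ 0<k₁ 0<k₂ eq _ _ _ _ 𝔸⊆ → continue 0<k₁ 0<k₂ eq (⊻-move (reindexed k₁ k₂ eq) 𝔸⊆))
        (λ k₁ k₂ 0<k₁ 0<k₂ eq _ _ _ _ 𝔹⊆ → continue 0<k₁ 0<k₂ eq (∧-move (reindexed k₁ k₂ eq) 𝔹⊆))
        (λ k₁ k₂ 0<k₁ 0<k₂ eq σ f → continue 0<k₁ 0<k₂ eq (∨-move IsSplit IsSplit-─ (reindexed k₁ k₂ eq) σ f))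
        (λ k₁ k₂ 0<k₁ 0<k₂ eq σ f → continue 0<k₁ 0<k₂ eq (∨-move IsStrictSplit IsStrictSplit-─ (reindexed k₁ k₂ eq) σ f))
      where
      reindexed : ∀ k₁ k₂ → k₁ + k₂ ≡ suc k → (k₁ + k₂) <D[ 𝔸 , 𝔹 ]
      reindexed _ _ eq = subst (_<D[ 𝔸 , 𝔹 ]) (sym eq) dense

      continue : ∀ {k₁ k₂ 𝔸₁ 𝔹₁ 𝔸₂ 𝔹₂} → 0 < k₁ → 0 < k₂ → k₁ + k₂ ≡ suc k →
        k₁ <D[ 𝔸₁ , 𝔹₁ ] ⊎ k₂ <D[ 𝔸₂ , 𝔹₂ ] → DWins k₁ 𝔸₁ 𝔹₁ ⊎ DWins k₂ 𝔸₂ 𝔹₂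
      continue {k₁} {k₂} 0<k₁ 0<k₂ eq =
        Sum.map (rec (subst (k₁ <_) eq (m<m+n k₁ 0<k₂))) (rec (subst (k₂ <_) eq (m<n+m k₂ 0<k₁)))

theorem3p8 : (n : ℕ) (𝔸₀ 𝔹₀ : Game.Team n → Bool) (k₀ : ℕ) →
    k₀ < Game.density n 𝔸₀ 𝔹₀ →
    Game.DWins n k₀ (Game.toPred n 𝔸₀) (Game.toPred n 𝔹₀)
theorem3p8 n 𝔸₀ 𝔹₀ k₀ k₀<D = Strategy.dense⇒DWins n k₀ (Strategy.density⇒dense n 𝔸₀ 𝔹₀ k₀<D)
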